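{- Let $n\geq 2$ and let $K\subsetneq 2^{[n]}$ be a simplicial complex. Let $H_0=\{x\in\mathbb{R}^n\mid x_1+\dots+x_n=0\}$ and $\delta_i:=e_i-\frac1n(e_1+\dots+e_n)\in H_0$ for $i\in[n]$. For $\tau=(A_1,A_2)\in Bier(K)$ put $B=[n]\setminus(A_1\cup A_2)$ and $$Cone(\tau)=\{x\in H_0\mid x_i\leq x_j \text{ for all } (i,j)\in (A_1\times B)\cup(B\times B)\cup(B\times A_2)\},$$ and let $Fan(K)=\{Cone(\tau)\}_{\tau\in Bier(K)}$. Then $$Fan(K)=\{\mathrm{cone}(\{ -\delta_i\}_{i\in S}\cup\{\delta_j\}_{j\in T})\mid (S,T)\in Bier(K)\},$$ where $\mathrm{cone}(V)$ denotes the set of nonnegative linear combinations of $V$ (with $\mathrm{cone}(\emptyset)=\{0\}$). Equivalently, $Fan(K)$ is the radial fan (the fan of cones from the origin) of the union of the geometric simplices $\mathrm{Conv}(\{ -\delta_i\}_{i\in S}\cup\{\delta_j\}_{j\in T})$, $(S,T)\in Bier(K)$.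
   Context: A simplicial complex $K\subseteq 2^{[n]}$ is a family of subsets closed under taking subsets. Its Alexander dual is $K^\circ=\{T\subseteq[n]\mid [n]\setminus T\notin K\}$. The Bier sphere is the deleted join $Bier(K)=K\ast_\Delta K^\circ=\{(S,T)\mid S\in K,\ T\in K^\circ,\ S\cap T=\emptyset\}$, a simplicial complex on the vertex set $\{1,\dots,n,\bar 1,\dots,\bar n\}$ (the pair $(S,T)$ being the simplex $S\cup\{\bar j\}_{j\in T}$); it triangulates the sphere $S^{n-2}$. For $(A_1,A_2)\in Bier(K)$ the set $B=[n]\setminus(A_1\cup A_2)$ is always nonempty. -}

module Defs where

open import Level using (0ℓ)
open import Data.Nat using (ℕ; zero; suc)
open import Data.Fin using (Fin)
open import Data.Fin.Subset using (Subset; _∈_; _∉_; _⊆_; ∁; ⊥; ⊤)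
open import Data.Product using (Σ; ∃; _×_; _,_)
open import Relation.Nullary using (¬_)
open import Relation.Binary.PropositionalEquality using (_≡_)
open import Relation.Binary.Structures using (IsTotalOrder)
open import Algebra.Structures using (IsCommutativeRing)
open import Function.Bundles using (_⇔_)
import Data.Fin
open import Data.Sum using (_⊎_)
import Data.Empty
import Relation.Nullary

-- A linearly ordered field (ℝ is the intended model).  Inverse is total
-- with the usual convention that 0⁻¹ is junk; the axiom only concerns x ≢ 0.
record OrderedField : Set₁ where
  infixl 6 _+_ _-_
  infixl 7 _*_
  infix 4 _≤_
  field
    Carrier : Set
    _+_ _*_ : Carrier → Carrier → Carrier
    -_ : Carrier → Carrier
    0# 1# : Carrier
    _⁻¹ : Carrier → Carrier
    _≤_ : Carrier → Carrier → Set
    isCommutativeRing : IsCommutativeRing _≡_ _+_ _*_ -_ 0# 1#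
    0≢1 : ¬ (0# ≡ 1#)
    *-inverse : ∀ x → ¬ (x ≡ 0#) → x * (x ⁻¹) ≡ 1#
    isTotalOrder : IsTotalOrder _≡_ _≤_
    +-mono-≤ : ∀ {a b} c → a ≤ b → a + c ≤ b + c
    *-nonneg : ∀ {a b} → 0# ≤ a → 0# ≤ b → 0# ≤ a * b

  _-_ : Carrier → Carrier → Carrier
  a - b = a + (- b)

  fromℕ : ℕ → Carrier
  fromℕ zero = 0#
  fromℕ (suc m) = 1# + fromℕ m

  Σ[_] : ∀ {n} → (Fin n → Carrier) → Carrier
  Σ[_] {zero} f = 0#
  Σ[_] {suc n} f = f Fin.zero + Σ[_] (λ i → f (Fin.suc i))

module Geometry (F : OrderedField) where
  open OrderedField F

  Vector : ℕ → Set
  Vector n = Fin n → Carrier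

  VSet : ℕ → Set₁
  VSet n = Vector n → Set

  _≐_ : ∀ {n} → VSet n → VSet n → Set
  A ≐ B = ∀ x → (A x → B x) × (B x → A x)

  H₀ : ∀ {n} → VSet n
  H₀ x = Σ[ x ] ≡ 0#

  e : ∀ {n} → Fin n → Vector n
  e i k with i Data.Fin.≟ k
  ... | Relation.Nullary.yes _ = 1#
  ... | Relation.Nullary.no _ = 0#

  δ : ∀ {n} → Fin n → Vector n
  δ {n} i k = e i k - (fromℕ n) ⁻¹

  coneST : ∀ {n} → Subset n → Subset n → VSet n
  coneST {n} S T x =
    Σ (Fin n → Carrier) λ c → Σ (Fin n → Carrier) λ d →
      (∀ i → 0# ≤ c i) × (∀ i → i ∉ S → c i ≡ 0#) ×
      (∀ j → 0# ≤ d j) × (∀ j → j ∉ T → d j ≡ 0#) ×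
      (∀ k → x k ≡ Σ[ (λ i → c i * (- δ i k)) ] + Σ[ (λ j → d j * δ j k) ])

  Cone : ∀ {n} → Subset n → Subset n → VSet n
  Cone {n} A₁ A₂ x = H₀ x ×
    (∀ i j → ((i ∈ A₁ × inB j) ⊎ (inB i × inB j) ⊎ (inB i × j ∈ A₂)) → x i ≤ x j)
    where
    inB : Fin n → Set
    inB k = k ∉ A₁ × k ∉ A₂

IsSimplicialComplex : ∀ {n} → (Subset n → Set) → Set
IsSimplicialComplex {n} K = ∀ (S T : Subset n) → T ⊆ S → K S → K T

dual : ∀ {n} → (Subset n → Set) → (Subset n → Set)
dual K T = ¬ K (∁ T)

Disjoint : ∀ {n} → Subset n → Subset n → Set
Disjoint S T = ∀ i → i ∈ S → i ∈ T → Data.Empty.⊥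

Bier : ∀ {n} → (Subset n → Set) → Subset n → Subset n → Set
Bier K S T = K S × dual K T × Disjoint S T

-- A point x ∈ H₀ lies in Cone(A₁,A₂) iff, for a common level μ, its coordinates
-- are ≤ μ on A₁, = μ on B and ≥ μ on A₂; B ≠ ∅ because A₂ ∈ K° forbids
-- ∁A₂ ⊆ A₁.  Since δᵢ = eᵢ − (1/n)·𝟙, a combination x = Σ cᵢ(−δᵢ) + Σ dⱼδⱼ has
-- xₖ = (dₖ − cₖ) + (Σc − Σd)/n, so with c supported on A₁ and d on A₂ it is
-- exactly such a point with μ = (Σc − Σd)/n; conversely take cᵢ = μ − xᵢ on A₁
-- and dⱼ = xⱼ − μ on A₂.
{-# OPTIONS --safe #-}
module Submission where

open import Defs
open import Data.Nat using (ℕ; _≤_; zero; suc)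
open import Data.Fin using (Fin; zero; suc; _≟_)
open import Data.Fin.Properties using (suc-injective; any?)
open import Data.Fin.Subset using (Subset; ⊥; _∈_; _∉_; ∁)
open import Data.Fin.Subset.Properties using (_∈?_; x∈∁p⇒x∉p)
open import Data.Product using (Σ; ∃; _×_; _,_; swap)
open import Data.Sum using (_⊎_; inj₁; inj₂)
open import Data.Empty using (⊥-elim)
open import Relation.Nullary using (¬_; Dec; yes; no; ¬?)
open import Relation.Nullary.Decidable using (_×-dec_)
open import Relation.Binary.PropositionalEquality
  using (_≡_; refl; sym; trans; cong; cong₂; subst; subst₂; module ≡-Reasoning)
open import Relation.Binary.Structures using (IsTotalOrder)
open import Algebra.Bundles using (CommutativeRing)

module Cones (F : OrderedField) where
  open OrderedField F hiding (_≤_)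
  open OrderedField F using () renaming (_≤_ to _≤F_)
  open Geometry F
  open IsTotalOrder isTotalOrder using (total; antisym; reflexive)
    renaming (trans to ≤-trans)

  private
    ring : CommutativeRing _ _
    ring = record { isCommutativeRing = isCommutativeRing }

  open CommutativeRing ring
    using (+-identityˡ; +-identityʳ; *-identityˡ; *-identityʳ; zeroˡ; zeroʳ; +-comm; *-assoc;
           -‿inverseˡ; -‿inverseʳ; distribʳ; +-commutativeSemigroup; *-commutativeSemigroup)
  open import Algebra.Properties.Ring (CommutativeRing.ring ring)
    using (-0#≈0#; -‿involutive; -‿+-comm; -‿distribʳ-*; x[y-z]≈xy-xz; [y-z]x≈yx-zx;
           ⁻¹-anti-homo‿-; //-rightDividesˡ; x≈y⇒x∙y⁻¹≈ε)
  open import Algebra.Properties.CommutativeSemigroup +-commutativeSemigroup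
    using (interchange)
  open import Algebra.Properties.CommutativeSemigroup *-commutativeSemigroup
    using (x∙yz≈y∙xz)

  x-0≡x : ∀ x → x - 0# ≡ x
  x-0≡x x = trans (cong (x +_) -0#≈0#) (+-identityʳ x)

  0-x≡-x : ∀ x → 0# - x ≡ - x
  0-x≡-x x = +-identityˡ (- x)

  Σ-cong : ∀ {n} {f g : Vector n} → (∀ i → f i ≡ g i) → Σ[ f ] ≡ Σ[ g ]
  Σ-cong {zero} f≗g = refl
  Σ-cong {suc n} f≗g = cong₂ _+_ (f≗g zero) (Σ-cong (λ i → f≗g (suc i)))

  Σ-+ : ∀ {n} (f g : Vector n) → Σ[ (λ i → f i + g i) ] ≡ Σ[ f ] + Σ[ g ]
  Σ-+ {zero} f g = sym (+-identityʳ 0#)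
  Σ-+ {suc n} f g = trans (cong (f zero + g zero +_) (Σ-+ (λ i → f (suc i)) (λ i → g (suc i))))
                          (interchange _ _ _ _)

  Σ-neg : ∀ {n} (f : Vector n) → Σ[ (λ i → - f i) ] ≡ - Σ[ f ]
  Σ-neg {zero} f = sym -0#≈0#
  Σ-neg {suc n} f = trans (cong (- f zero +_) (Σ-neg (λ i → f (suc i)))) (-‿+-comm _ _)

  Σ-- : ∀ {n} (f g : Vector n) → Σ[ (λ i → f i - g i) ] ≡ Σ[ f ] - Σ[ g ]
  Σ-- f g = trans (Σ-+ f (λ i → - g i)) (cong (Σ[ f ] +_) (Σ-neg g))

  Σ-*ʳ : ∀ {n} (f : Vector n) a → Σ[ (λ i → f i * a) ] ≡ Σ[ f ] * a
  Σ-*ʳ {zero} f a = sym (zeroˡ a)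
  Σ-*ʳ {suc n} f a = trans (cong (f zero * a +_) (Σ-*ʳ (λ i → f (suc i)) a)) (sym (distribʳ a _ _))

  Σ-const : ∀ {n} a → Σ[ (λ (_ : Fin n) → a) ] ≡ fromℕ n * a
  Σ-const {zero} a = sym (zeroˡ a)
  Σ-const {suc n} a = trans (cong (a +_) (Σ-const {n} a))
    (trans (cong (_+ fromℕ n * a) (sym (*-identityˡ a))) (sym (distribʳ a 1# (fromℕ n))))

  Σ-single : ∀ {n} (g : Vector n) k → (∀ i → ¬ i ≡ k → g i ≡ 0#) → Σ[ g ] ≡ g k
  Σ-single {suc n} g zero g≡0 =
    trans (cong (g zero +_) (trans (Σ-cong {g = λ _ → 0#} (λ i → g≡0 (suc i) λ ()))
                                   (trans (Σ-const {n} 0#) (zeroʳ _))))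
          (+-identityʳ _)
  Σ-single {suc n} g (suc k) g≡0 =
    trans (cong₂ _+_ (g≡0 zero λ ()) (Σ-single (λ i → g (suc i)) k
                                        (λ i i≢k → g≡0 (suc i) (λ eq → i≢k (suc-injective eq)))))
          (+-identityˡ _)

  e-diagonal : ∀ {n} (i : Fin n) → e i i ≡ 1#
  e-diagonal i with i ≟ i
  ... | yes _ = refl
  ... | no i≢i = ⊥-elim (i≢i refl)

  e-offDiagonal : ∀ {n} (i k : Fin n) → ¬ i ≡ k → e i k ≡ 0#
  e-offDiagonal i k i≢k with i ≟ k
  ... | yes i≡k = ⊥-elim (i≢k i≡k)
  ... | no _ = refl

  Σ-*-e : ∀ {n} (f : Vector n) k → Σ[ (λ i → f i * e i k) ] ≡ f k
  Σ-*-e f k = begin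
      Σ[ (λ i → f i * e i k) ]
    ≡⟨ Σ-single _ k (λ i i≢k → trans (cong (f i *_) (e-offDiagonal i k i≢k)) (zeroʳ _)) ⟩
      f k * e k k
    ≡⟨ trans (cong (f k *_) (e-diagonal k)) (*-identityʳ _) ⟩
      f k
    ∎
    where open ≡-Reasoning

  Σ-*-δ : ∀ {n} (f : Vector n) k → Σ[ (λ i → f i * δ i k) ] ≡ f k - Σ[ f ] * fromℕ n ⁻¹
  Σ-*-δ {n} f k = begin
      Σ[ (λ i → f i * δ i k) ]
    ≡⟨ Σ-cong (λ i → x[y-z]≈xy-xz (f i) (e i k) (fromℕ n ⁻¹)) ⟩
      Σ[ (λ i → f i * e i k - f i * fromℕ n ⁻¹) ]
    ≡⟨ Σ-- {n} _ _ ⟩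
      Σ[ (λ i → f i * e i k) ] - Σ[ (λ i → f i * fromℕ n ⁻¹) ]
    ≡⟨ cong₂ _-_ (Σ-*-e f k) (Σ-*ʳ f _) ⟩
      f k - Σ[ f ] * fromℕ n ⁻¹
    ∎
    where open ≡-Reasoning

  combination : ∀ {n} → Vector n → Vector n → Vector n
  combination c d k = Σ[ (λ i → c i * (- δ i k)) ] + Σ[ (λ j → d j * δ j k) ]

  level : ∀ {n} → Vector n → Vector n → Carrier
  level {n} c d = (Σ[ c ] - Σ[ d ]) * fromℕ n ⁻¹

  combination-expand : ∀ {n} (c d : Vector n) k →
                       combination c d k ≡ (d k - c k) + level c d
  combination-expand {n} c d k = begin
      Σ[ (λ i → c i * (- δ i k)) ] + Σ[ (λ j → d j * δ j k) ]
    ≡⟨ cong (_+ Σ[ (λ j → d j * δ j k) ]) (Σ-cong (λ i → sym (-‿distribʳ-* (c i) (δ i k)))) ⟩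
      Σ[ (λ i → - (c i * δ i k)) ] + Σ[ (λ j → d j * δ j k) ]
    ≡⟨ cong₂ _+_ (trans (Σ-neg {n} _) (cong -_ (Σ-*-δ c k))) (Σ-*-δ d k) ⟩
      - (c k - C) + (d k - D)
    ≡⟨ cong (_+ (d k - D)) (⁻¹-anti-homo‿- (c k) C) ⟩
      (C - c k) + (d k - D)
    ≡⟨ cong (_+ (d k - D)) (+-comm C (- c k)) ⟩
      (- c k + C) + (d k - D)
    ≡⟨ interchange _ _ _ _ ⟩
      (- c k + d k) + (C - D)
    ≡⟨ cong (_+ (C - D)) (+-comm (- c k) (d k)) ⟩
      (d k - c k) + (C - D)
    ≡⟨ cong (d k - c k +_) (sym ([y-z]x≈yx-zx (fromℕ n ⁻¹) Σ[ c ] Σ[ d ])) ⟩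
      (d k - c k) + level c d
    ∎
    where
    open ≡-Reasoning
    C = Σ[ c ] * fromℕ n ⁻¹
    D = Σ[ d ] * fromℕ n ⁻¹

  x≤y⇒0≤y-x : ∀ {x y} → x ≤F y → 0# ≤F y - x
  x≤y⇒0≤y-x {x} {y} x≤y = subst (_≤F y - x) (-‿inverseʳ x) (+-mono-≤ (- x) x≤y)

  x≤x+y : ∀ x {y} → 0# ≤F y → x ≤F x + y
  x≤x+y x {y} 0≤y = subst₂ _≤F_ (+-identityˡ x) (+-comm y x) (+-mono-≤ x 0≤y)

  x-y≤x : ∀ x {y} → 0# ≤F y → x - y ≤F x
  x-y≤x x {y} 0≤y = subst (x - y ≤F_) (//-rightDividesˡ y x) (x≤x+y (x - y) 0≤y)

  -- 1 ≤ 0 would give 0 ≤ −1, hence 0 ≤ (−1)(−1) = 1.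
  0≤1 : 0# ≤F 1#
  0≤1 with total 0# 1#
  ... | inj₁ 0≤1 = 0≤1
  ... | inj₂ 1≤0 = subst (0# ≤F_) (trans (sym (-‿distribʳ-* (- 1#) 1#))
                                        (trans (cong -_ (*-identityʳ _)) (-‿involutive 1#)))
                           (*-nonneg 0≤-1 0≤-1)
    where
    0≤-1 : 0# ≤F - 1#
    0≤-1 = subst₂ _≤F_ (-‿inverseʳ 1#) (+-identityˡ _) (+-mono-≤ (- 1#) 1≤0)

  1≤fromℕ-suc : ∀ m → 1# ≤F fromℕ (suc m)
  1≤fromℕ-suc zero = subst (1# ≤F_) (sym (+-identityʳ 1#)) (reflexive refl)
  1≤fromℕ-suc (suc m) =
    ≤-trans (1≤fromℕ-suc m) (subst (fromℕ (suc m) ≤F_) (+-comm _ 1#) (x≤x+y (fromℕ (suc m)) 0≤1))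

  fromℕ-suc≢0 : ∀ m → ¬ fromℕ (suc m) ≡ 0#
  fromℕ-suc≢0 m eq = 0≢1 (antisym 0≤1 (subst (1# ≤F_) eq (1≤fromℕ-suc m)))

  fromℕ-suc*[x*inverse]≡x : ∀ m x → fromℕ (suc m) * (x * fromℕ (suc m) ⁻¹) ≡ x
  fromℕ-suc*[x*inverse]≡x m x = begin
      N * (x * N ⁻¹)
    ≡⟨ x∙yz≈y∙xz N x (N ⁻¹) ⟩
      x * (N * N ⁻¹)
    ≡⟨ cong (x *_) (*-inverse N (fromℕ-suc≢0 m)) ⟩
      x * 1#
    ≡⟨ *-identityʳ x ⟩
      x
    ∎
    where
    open ≡-Reasoning
    N = fromℕ (suc m)

  combination∈H₀ : ∀ {n} (c d : Vector n) → H₀ (combination c d)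
  combination∈H₀ {zero} c d = refl
  combination∈H₀ {suc m} c d = begin
      Σ[ combination c d ]
    ≡⟨ Σ-cong (combination-expand c d) ⟩
      Σ[ (λ k → (d k - c k) + level c d) ]
    ≡⟨ Σ-+ (λ k → d k - c k) (λ _ → level c d) ⟩
      Σ[ (λ k → d k - c k) ] + Σ[ (λ (_ : Fin (suc m)) → level c d) ]
    ≡⟨ cong₂ _+_ (Σ-- d c) (Σ-const {suc m} (level c d)) ⟩
      (Σ[ d ] - Σ[ c ]) + fromℕ (suc m) * level c d
    ≡⟨ cong₂ _+_ (sym (⁻¹-anti-homo‿- Σ[ c ] Σ[ d ])) (fromℕ-suc*[x*inverse]≡x m _) ⟩
      - (Σ[ c ] - Σ[ d ]) + (Σ[ c ] - Σ[ d ])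
    ≡⟨ -‿inverseˡ _ ⟩
      0#
    ∎
    where open ≡-Reasoning

  level-unique : ∀ {m} {c d x : Vector (suc m)} {μ} → H₀ x →
                 (∀ k → d k - c k ≡ x k - μ) → level c d ≡ μ
  level-unique {m} {c} {d} {x} {μ} Σx≡0 d-c≡x-μ = begin
      (Σ[ c ] - Σ[ d ]) * N ⁻¹
    ≡⟨ cong (_* N ⁻¹) (sym (⁻¹-anti-homo‿- Σ[ d ] Σ[ c ])) ⟩
      - (Σ[ d ] - Σ[ c ]) * N ⁻¹
    ≡⟨ cong (λ z → - z * N ⁻¹) (trans (sym (Σ-- d c)) (Σ-cong d-c≡x-μ)) ⟩
      - Σ[ (λ k → x k - μ) ] * N ⁻¹
    ≡⟨ cong (λ z → - z * N ⁻¹) (Σ-- {suc m} x (λ _ → μ)) ⟩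
      - (Σ[ x ] - Σ[ (λ (_ : Fin (suc m)) → μ) ]) * N ⁻¹
    ≡⟨ cong (λ z → - z * N ⁻¹) (cong₂ _-_ Σx≡0 (Σ-const {suc m} μ)) ⟩
      - (0# - N * μ) * N ⁻¹
    ≡⟨ cong (_* N ⁻¹) (trans (cong -_ (0-x≡-x (N * μ))) (-‿involutive (N * μ))) ⟩
      (N * μ) * N ⁻¹
    ≡⟨ *-assoc N μ (N ⁻¹) ⟩
      N * (μ * N ⁻¹)
    ≡⟨ fromℕ-suc*[x*inverse]≡x m μ ⟩
      μ
    ∎
    where
    open ≡-Reasoning
    N = fromℕ (suc m)

  record Levelled {n} (A₁ A₂ : Subset n) (x : Vector n) (μ : Carrier) : Set where
    field
      below : ∀ i → i ∈ A₁ → x i ≤F μ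
      at    : ∀ i → i ∉ A₁ → i ∉ A₂ → x i ≡ μ
      above : ∀ i → i ∈ A₂ → μ ≤F x i

  Levelled⇒Cone : ∀ {n} {A₁ A₂ : Subset n} {x μ} → H₀ x → Levelled A₁ A₂ x μ → Cone A₁ A₂ x
  Levelled⇒Cone {A₁ = A₁} {A₂} {x} Σx≡0 lev = Σx≡0 , ordered
    where
    open Levelled lev
    Outside : Fin _ → Set
    Outside k = k ∉ A₁ × k ∉ A₂
    ordered : ∀ i j → (i ∈ A₁ × Outside j) ⊎ (Outside i × Outside j) ⊎ (Outside i × j ∈ A₂) →
              x i ≤F x j
    ordered i j (inj₁ (i∈A₁ , j∉A₁ , j∉A₂)) =
      subst (x i ≤F_) (sym (at j j∉A₁ j∉A₂)) (below i i∈A₁)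
    ordered i j (inj₂ (inj₁ ((i∉A₁ , i∉A₂) , (j∉A₁ , j∉A₂)))) =
      reflexive (trans (at i i∉A₁ i∉A₂) (sym (at j j∉A₁ j∉A₂)))
    ordered i j (inj₂ (inj₂ ((i∉A₁ , i∉A₂) , j∈A₂))) =
      subst (_≤F x j) (sym (at i i∉A₁ i∉A₂)) (above j j∈A₂)

  Cone⇒Levelled : ∀ {n} {A₁ A₂ : Subset n} {x} b → b ∉ A₁ → b ∉ A₂ →
                  Cone A₁ A₂ x → Levelled A₁ A₂ x (x b)
  Cone⇒Levelled b b∉A₁ b∉A₂ (_ , ordered) = record
    { below = λ i i∈A₁ → ordered i b (inj₁ (i∈A₁ , b∉A₁ , b∉A₂))
    ; at    = λ i i∉A₁ i∉A₂ → antisym (ordered i b (inj₂ (inj₁ ((i∉A₁ , i∉A₂) , (b∉A₁ , b∉A₂)))))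
                                      (ordered b i (inj₂ (inj₁ ((b∉A₁ , b∉A₂) , (i∉A₁ , i∉A₂)))))
    ; above = λ j j∈A₂ → ordered b j (inj₂ (inj₂ ((b∉A₁ , b∉A₂) , j∈A₂)))
    }

  _↾_ : ∀ {n} → Vector n → Subset n → Vector n
  (f ↾ A) i with i ∈? A
  ... | yes _ = f i
  ... | no _ = 0#

  ↾-∈ : ∀ {n} (f : Vector n) {A i} → i ∈ A → (f ↾ A) i ≡ f i
  ↾-∈ f {A} {i} i∈A with i ∈? A
  ... | yes _ = refl
  ... | no i∉A = ⊥-elim (i∉A i∈A)

  ↾-∉ : ∀ {n} (f : Vector n) {A i} → i ∉ A → (f ↾ A) i ≡ 0#
  ↾-∉ f {A} {i} i∉A with i ∈? A
  ... | yes i∈A = ⊥-elim (i∉A i∈A)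
  ... | no _ = refl

  ↾-nonneg : ∀ {n} {f : Vector n} {A} → (∀ i → i ∈ A → 0# ≤F f i) → ∀ i → 0# ≤F (f ↾ A) i
  ↾-nonneg {A = A} 0≤f i with i ∈? A
  ... | yes i∈A = 0≤f i i∈A
  ... | no _ = reflexive refl

  coneST⇒Levelled : ∀ {n} {A₁ A₂ : Subset n} {x} → Disjoint A₁ A₂ → coneST A₁ A₂ x →
                    H₀ x × ∃ (Levelled A₁ A₂ x)
  coneST⇒Levelled {A₁ = A₁} {A₂} {x} disjoint (c , d , 0≤c , c-supp , 0≤d , d-supp , x≡combination) =
    trans (Σ-cong x≡combination) (combination∈H₀ c d) ,
    μ , record { below = below ; at = at ; above = above }
    where
    open ≡-Reasoning
    μ = level c d
    x≡ : ∀ k → x k ≡ (d k - c k) + μ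
    x≡ k = trans (x≡combination k) (combination-expand c d k)
    below : ∀ i → i ∈ A₁ → x i ≤F μ
    below i i∈A₁ = subst (_≤F μ) (sym (begin
        x i                ≡⟨ x≡ i ⟩
        (d i - c i) + μ    ≡⟨ cong (λ z → (z - c i) + μ) (d-supp i (disjoint i i∈A₁)) ⟩
        (0# - c i) + μ     ≡⟨ trans (cong (_+ μ) (0-x≡-x (c i))) (+-comm _ μ) ⟩
        μ - c i            ∎))
      (x-y≤x μ (0≤c i))
    at : ∀ i → i ∉ A₁ → i ∉ A₂ → x i ≡ μ
    at i i∉A₁ i∉A₂ = begin
        x i                ≡⟨ x≡ i ⟩
        (d i - c i) + μ    ≡⟨ cong₂ (λ u v → (u - v) + μ) (d-supp i i∉A₂) (c-supp i i∉A₁) ⟩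
        (0# - 0#) + μ      ≡⟨ trans (cong (_+ μ) (x-0≡x 0#)) (+-identityˡ μ) ⟩
        μ                  ∎
    above : ∀ j → j ∈ A₂ → μ ≤F x j
    above j j∈A₂ = subst (μ ≤F_) (sym (begin
        x j                ≡⟨ x≡ j ⟩
        (d j - c j) + μ    ≡⟨ cong (λ z → (d j - z) + μ) (c-supp j (λ j∈A₁ → disjoint j j∈A₁ j∈A₂)) ⟩
        (d j - 0#) + μ     ≡⟨ trans (cong (_+ μ) (x-0≡x (d j))) (+-comm _ μ) ⟩
        μ + d j            ∎))
      (x≤x+y μ (0≤d j))

  Levelled⇒coneST : ∀ {m} {A₁ A₂ : Subset (suc m)} {x μ} → Disjoint A₁ A₂ → H₀ x →
                    Levelled A₁ A₂ x μ → coneST A₁ A₂ x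
  Levelled⇒coneST {A₁ = A₁} {A₂} {x} {μ} disjoint Σx≡0 lev =
    c , d , ↾-nonneg (λ i i∈A₁ → x≤y⇒0≤y-x (below i i∈A₁)) , (λ i → ↾-∉ _) ,
            ↾-nonneg (λ j j∈A₂ → x≤y⇒0≤y-x (above j j∈A₂)) , (λ j → ↾-∉ _) , x≡combination
    where
    open Levelled lev
    open ≡-Reasoning
    c d : Vector _
    c = (λ i → μ - x i) ↾ A₁
    d = (λ j → x j - μ) ↾ A₂
    d-c≡x-μ : ∀ k → d k - c k ≡ x k - μ
    d-c≡x-μ k = by-cases (k ∈? A₁) (k ∈? A₂)
      where
      by-cases : Dec (k ∈ A₁) → Dec (k ∈ A₂) → d k - c k ≡ x k - μ
      by-cases (yes k∈A₁) _ = begin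
          d k - c k          ≡⟨ cong₂ _-_ (↾-∉ _ (disjoint k k∈A₁)) (↾-∈ _ k∈A₁) ⟩
          0# - (μ - x k)     ≡⟨ 0-x≡-x _ ⟩
          - (μ - x k)        ≡⟨ ⁻¹-anti-homo‿- μ (x k) ⟩
          x k - μ            ∎
      by-cases (no k∉A₁) (yes k∈A₂) = trans (cong₂ _-_ (↾-∈ _ k∈A₂) (↾-∉ _ k∉A₁)) (x-0≡x _)
      by-cases (no k∉A₁) (no k∉A₂) = begin
          d k - c k          ≡⟨ cong₂ _-_ (↾-∉ _ k∉A₂) (↾-∉ _ k∉A₁) ⟩
          0# - 0#            ≡⟨ x-0≡x 0# ⟩
          0#                 ≡⟨ sym (x≈y⇒x∙y⁻¹≈ε (at k k∉A₁ k∉A₂)) ⟩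
          x k - μ            ∎
    x≡combination : ∀ k → x k ≡ combination c d k
    x≡combination k = sym (begin
        combination c d k       ≡⟨ combination-expand c d k ⟩
        (d k - c k) + level c d ≡⟨ cong₂ _+_ (d-c≡x-μ k) (level-unique Σx≡0 d-c≡x-μ) ⟩
        (x k - μ) + μ           ≡⟨ //-rightDividesˡ μ (x k) ⟩
        x k                     ∎)

  Cone≐coneST : ∀ {n} {A₁ A₂ : Subset n} → Disjoint A₁ A₂ → ∀ b → b ∉ A₁ → b ∉ A₂ →
                Cone A₁ A₂ ≐ coneST A₁ A₂
  Cone≐coneST {suc m} disjoint b b∉A₁ b∉A₂ x =
    (λ x∈Cone@(Σx≡0 , _) → Levelled⇒coneST disjoint Σx≡0 (Cone⇒Levelled b b∉A₁ b∉A₂ x∈Cone)) ,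
    (λ x∈coneST → let (Σx≡0 , _ , lev) = coneST⇒Levelled disjoint x∈coneST in Levelled⇒Cone Σx≡0 lev)

Bier⇒uncovered : ∀ {n} {K : Subset n → Set} → IsSimplicialComplex K → ∀ {A₁ A₂} →
                 Bier K A₁ A₂ → ∃ λ b → b ∉ A₁ × b ∉ A₂
Bier⇒uncovered K-closed {A₁} {A₂} (A₁∈K , A₂∈K° , _)
  with any? (λ k → ¬? (k ∈? A₁) ×-dec ¬? (k ∈? A₂))
... | yes uncovered = uncovered
... | no ∄uncovered = ⊥-elim (A₂∈K° (K-closed A₁ (∁ A₂) ∁A₂⊆A₁ A₁∈K))
  where
  ∁A₂⊆A₁ : ∀ {k} → k ∈ ∁ A₂ → k ∈ A₁
  ∁A₂⊆A₁ {k} k∈∁A₂ with k ∈? A₁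
  ... | yes k∈A₁ = k∈A₁
  ... | no k∉A₁ = ⊥-elim (∄uncovered (k , k∉A₁ , x∈∁p⇒x∉p k∈∁A₂))

proposition1 : (F : OrderedField) (n : ℕ) → 2 ≤ n →
    (K : Subset n → Set) → IsSimplicialComplex K → K ⊥ → ¬ (∀ S → K S) →
    let open Geometry F in
    (∀ A₁ A₂ → Bier K A₁ A₂ →
      Σ (Subset n) λ S → Σ (Subset n) λ T → Bier K S T × (Cone A₁ A₂ ≐ coneST S T))
    ×
    (∀ S T → Bier K S T →
      Σ (Subset n) λ A₁ → Σ (Subset n) λ A₂ → Bier K A₁ A₂ × (coneST S T ≐ Cone A₁ A₂))
proposition1 F n _ K K-closed _ _ =
    (λ A₁ A₂ τ → A₁ , A₂ , τ , Cone≐coneST-on τ)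
  , (λ S T τ → S , T , τ , λ x → swap (Cone≐coneST-on τ x))
  where
  open Geometry F
  open Cones F using (Cone≐coneST)
  Cone≐coneST-on : ∀ {A₁ A₂} → Bier K A₁ A₂ → Cone A₁ A₂ ≐ coneST A₁ A₂
  Cone≐coneST-on τ@(_ , _ , disjoint) =
    let (b , b∉A₁ , b∉A₂) = Bier⇒uncovered K-closed τ in Cone≐coneST disjoint b b∉A₁ b∉A₂
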